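{- Let $G=(S,\mathit{Tr},\mathrm{src},\mathrm{tgt},S_0)$ be a transition system with functions $\mathrm{instr}:\mathit{Tr}\to\mathcal{P}(\mathcal{I})$ and $\mathrm{comp}:\mathit{Tr}\to\mathcal{P}(\mathcal{C})$, $\mathrm{instr}(t)\neq\emptyset\neq\mathrm{comp}(t)$, and assume there is $\mathrm{cmp}:\mathcal{I}\to\mathcal{C}$ with $\mathrm{comp}(t)=\{\mathrm{cmp}(I)\mid I\in\mathrm{instr}(t)\}$ for all $t$. Then $\mathrm{J}y\preceq\mathrm{J}$ for every $y\in\{\mathrm{T},\mathrm{Z},\mathrm{G}\}$: every just path is $\mathrm{J}y$-fair.
   Context: A transition system is $G=(S,\mathit{Tr},\mathrm{src},\mathrm{tgt},S_0)$ with states, transitions, $\mathrm{src},\mathrm{tgt}:\mathit{Tr}\to S$, initial states. A path is an alternating sequence $s_0t_1s_1t_2\cdots$ of states and transitions, starting with a state, infinite or ending with a state, with $\mathrm{src}(t_i)=s_{i-1}$, $\mathrm{tgt}(t_i)=s_i$. A suffix of $s_0t_1s_1\cdots$ is $s_kt_{k+1}s_{k+1}\cdots$. Write $t\smile u$ iff $\mathrm{comp}(t)\cap\mathrm{comp}(u)=\emptyset$. For a task $T\subseteq\mathit{Tr}$: $T$ is enabled in state $s$ if some $t\in T$ has $\mathrm{src}(t)=s$; enabled during a transition $u$ if there is $t\in T$ with $\mathrm{src}(t)=\mathrm{src}(u)$ and $t\smile u$; continuously enabled on $\pi$ if enabled in every state and during every transition of $\pi$; occurs in $\pi$ if $\pi$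 contains a transition of $T$. A path $\pi$ is J-fair w.r.t. a task collection if for every suffix $\pi'$ each task continuously enabled on $\pi'$ occurs in $\pi'$. $\mathrm{J}y$-fairness is J-fairness w.r.t.: T: $\{\{t\}\mid t\in\mathit{Tr}\}$; Z: $\{T_Z\mid Z\subseteq\mathcal{I}\}$, $T_Z=\{t\mid\mathrm{instr}(t)=Z\}$; G: $\{T_H\mid H\subseteq\mathcal{C}\}$, $T_H=\{t\mid\mathrm{comp}(t)=H\}$. A path $\pi=s_0t_1s_1\cdots$ is just if for every position $i$ and every transition $t$ with $\mathrm{src}(t)=s_i$ there is $j>i$ with $\mathrm{comp}(t)\cap\mathrm{comp}(t_j)\neq\emptyset$. $H\preceq F$ means every path satisfying $F$ satisfies $H$. -}

module Defs where

open import Level using (0ℓ) renaming (suc to lsuc)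
open import Data.Nat using (ℕ; suc; _≤_)
open import Data.Maybe using (Maybe; just; nothing)
open import Data.Product using (Σ; ∃; _×_; _,_)
open import Data.Empty using (⊥)
open import Data.Unit using (⊤)
open import Relation.Binary.PropositionalEquality using (_≡_)
open import Relation.Unary using (Pred)
open import Function.Bundles using (_⇔_)

record TS : Set₁ where
  field
    S     : Set
    Tr    : Set
    src   : Tr → S
    tgt   : Tr → S
    S₀    : Pred S 0ℓ
    Ins   : Set
    Cmp   : Set
    instr : Tr → Pred Ins 0ℓ
    comp  : Tr → Pred Cmp 0ℓ

module _ (G : TS) where
  open TS G

  -- A path s₀ t₁ s₁ t₂ … : 'len = nothing' means infinite, 'len = just n'
  -- means it ends in state sₙ.  'st i' is sᵢ and 'tr i' is t_{i+1}.
  -- Values of st/tr beyond the length are irrelevant.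
  StIdx : Maybe ℕ → ℕ → Set
  StIdx nothing  i = ⊤
  StIdx (just n) i = i ≤ n

  TrIdx : Maybe ℕ → ℕ → Set
  TrIdx len i = StIdx len (suc i)

  record Path : Set where
    field
      len  : Maybe ℕ
      st   : ℕ → S
      tr   : ℕ → Tr
      src-ok : ∀ i → TrIdx len i → src (tr i) ≡ st i
      tgt-ok : ∀ i → TrIdx len i → tgt (tr i) ≡ st (suc i)

  _⌣_ : Tr → Tr → Set
  t ⌣ u = ∀ c → comp t c → comp u c → ⊥

  Task : Set₁
  Task = Pred Tr 0ℓ

  EnabledIn : Task → S → Set
  EnabledIn T s = ∃ λ t → T t × src t ≡ s

  EnabledDuring : Task → Tr → Set
  EnabledDuring T u = ∃ λ t → T t × src t ≡ src u × t ⌣ u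

  module _ (π : Path) where
    open Path π

    ContEnabledFrom : Task → ℕ → Set
    ContEnabledFrom T k =
      (∀ i → k ≤ i → StIdx len i → EnabledIn T (st i)) ×
      (∀ i → k ≤ i → TrIdx len i → EnabledDuring T (tr i))

    OccursFrom : Task → ℕ → Set
    OccursFrom T k = ∃ λ i → k ≤ i × TrIdx len i × T (tr i)

    JFair : {Idx : Set₁} → (Idx → Task) → Set₁
    JFair {Idx} task = ∀ k → StIdx len k → ∀ (x : Idx) →
      ContEnabledFrom (task x) k → OccursFrom (task x) k

    -- justness: for each position i and t with src t = sᵢ there is j > i
    -- with comp(t) ∩ comp(t_j) ≠ ∅ (here t_j = tr j' with j' ≥ i)
    Just : Set
    Just = ∀ i → StIdx len i → ∀ t → src t ≡ st i →
      ∃ λ j → i ≤ j × TrIdx len j × (∃ λ c → comp t c × comp (tr j) c)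

  data Y : Set where T Z Gy : Y

  _≐_ : {A : Set} → Pred A 0ℓ → Pred A 0ℓ → Set
  P ≐ Q = ∀ a → P a ⇔ Q a

  TaskIdx : Y → Set₁
  TaskIdx T  = Level.Lift (lsuc 0ℓ) Tr
  TaskIdx Z  = Pred Ins 0ℓ
  TaskIdx Gy = Pred Cmp 0ℓ

  tasks : (y : Y) → TaskIdx y → Task
  tasks T  (Level.lift t) = λ u → u ≡ t
  tasks Z  Zs = λ t → instr t ≐ Zs
  tasks Gy H  = λ t → comp t ≐ H

  JyFair : Y → Path → Set₁
  JyFair y π = JFair π (tasks y)

-- Every task of the three collections is component-uniform: all of its
-- transitions have the same components (for instruction tasks because
-- comp t is the image of instr t under cmp).  On a just path such a task
-- cannot be continuously enabled from position k: take a witness t enabled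
-- in s_k; justness yields a later transition t_j sharing a component with t,
-- yet the witness t' enabled during t_j is disjoint from t_j although
-- comp t' = comp t.  Hence J-fairness holds vacuously for these collections.
module Submission where

open import Defs
open import Level using (lift)
open import Data.Product using (∃; _×_; _,_)
open import Data.Nat.Properties using (≤-refl)
open import Data.Empty using (⊥-elim)
open import Relation.Binary.PropositionalEquality using (_≡_; refl)
open import Relation.Nullary using (¬_)
open import Relation.Unary using (_⊆_)
open import Function.Bundles using (_⇔_; Equivalence)

open Equivalence using (to; from)

module _ (G : TS) where
  open TS G

  ComponentUniform : Task G → Set
  ComponentUniform task = ∀ {t u} → task t → task u → comp t ⊆ comp u

  module _ (π : Path G) (just : Just G π) where
    open Path π

    just⇒¬contEnabled : ∀ {task} → ComponentUniform task →
      ∀ k → StIdx G len k → ¬ ContEnabledFrom G π task k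
    just⇒¬contEnabled uniform k sk (enabledIn , enabledDuring)
      with enabledIn k ≤-refl sk
    ... | t , Tt , src-t with just k sk t src-t
    ... | j , k≤j , tj , c , c∈t , c∈tj with enabledDuring j k≤j tj
    ... | t′ , Tt′ , _ , t′⌣tj = t′⌣tj c (uniform Tt Tt′ c∈t) c∈tj

    just⇒JFair : ∀ {Idx : Set₁} (task : Idx → Task G) →
      (∀ x → ComponentUniform (task x)) → JFair G π task
    just⇒JFair task uniform k sk x enabled =
      ⊥-elim (just⇒¬contEnabled (uniform x) k sk enabled)

  singleton-uniform : ∀ t → ComponentUniform (tasks G T (lift t))
  singleton-uniform t refl refl c∈t = c∈t

  component-uniform : ∀ H → ComponentUniform (tasks G Gy H)
  component-uniform H t≐H u≐H c∈t = from (u≐H _) (to (t≐H _) c∈t)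

  instruction-uniform : (cmp : Ins → Cmp) →
    (∀ t c → comp t c ⇔ (∃ λ i → instr t i × cmp i ≡ c)) →
    ∀ Zs → ComponentUniform (tasks G Z Zs)
  instruction-uniform cmp comp≡cmp[instr] Zs {t} {u} t≐Zs u≐Zs {c} c∈t
    with to (comp≡cmp[instr] t c) c∈t
  ... | i , i∈t , cmp-i≡c =
    from (comp≡cmp[instr] u c) (i , from (u≐Zs i) (to (t≐Zs i) i∈t) , cmp-i≡c)

proposition14p4 : (G : TS) →
    (∀ t → ∃ λ i → TS.instr G t i) →
    (∀ t → ∃ λ c → TS.comp G t c) →
    (∃ λ (cmp : TS.Ins G → TS.Cmp G) →
       ∀ t c → TS.comp G t c ⇔ (∃ λ i → TS.instr G t i × cmp i ≡ c)) →
    (y : Y G) → (π : Path G) → Just G π → JyFair G y π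
proposition14p4 G _ _ (cmp , comp≡cmp[instr]) y π just =
  just⇒JFair G π just (tasks G y) (uniform y)
  where
  uniform : ∀ y x → ComponentUniform G (tasks G y x)
  uniform T  (lift t) = singleton-uniform G t
  uniform Z  Zs       = instruction-uniform G cmp comp≡cmp[instr] Zs
  uniform Gy H        = component-uniform G H
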